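{- There exists a sequence of polynomials $\{P_r(k): r\ge 0\}$ such that for all integers $r\ge 0$ and $k\ge 1$, \[ \mathcal{S}_{2r+1}^{(k)}(1)=P_r(k)\,\frac{k}{2}\binom{2k}{k}, \] where $\mathcal{S}_{m}^{(k)}(1)=\sum_{q=0}^{k-1}\binom{2k}{q}(k-q)^m$.
   Context: $\mathcal{S}_{m}^{(k)}(1)$ is the value at $n=1$ of the binomial sum $\mathcal S^{(k)}_m(n)=\sum_{q=0}^{k-1}\binom{k(n+1)}{q}S^{(k-q)}_m(n)$, where $S^{(j)}_m(n)$ are defined by $\big(\sum_{p=1}^n e^{pt}\big)^j=\sum_{m\ge0}S^{(j)}_m(n)t^m/m!$; since $S^{(j)}_m(1)=j^m$, it equals the explicit sum in the claim. -}

module Defs where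

open import Data.Nat using (ℕ; _+_; _*_; _∸_; _^_)
open import Data.Nat.Combinatorics using (_C_)
open import Data.List using (List; []; _∷_; map; upTo)
open import Data.Nat.ListAction using (sum)
open import Data.Integer using (+_)
import Data.Rational as ℚ
open ℚ using (ℚ)

-- Polynomials with rational coefficients, as coefficient lists
-- [a₀, a₁, …, aₙ] representing a₀ + a₁ x + … + aₙ xⁿ.
Poly : Set
Poly = List ℚ

eval : Poly → ℚ → ℚ
eval []       x = ℚ.0ℚ
eval (a ∷ as) x = a ℚ.+ x ℚ.* eval as x

calS : ℕ → ℕ → ℕ
calS m k = sum (map (λ q → ((2 * k) C q) * ((k ∸ q) ^ m)) (upTo k))

toℚ : ℕ → ℚ
toℚ n = (+ n) ℚ./ 1

module Submission where

-- For k ∈ ℕ put S_m(k) = Σ_{q<k} C(2k,q) (k-q)^m.  The proof shows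
--
--   2 S_{2r+1}(k) = P_r(k) · k C(2k,k),   P₀ = 1,
--   P_{r+1}(x) = x² P_r(x) - x(x-1) P_r(x-1),
--
-- Two facts about binomial coefficients drive it:
--   * the first moment 2 S₁(k) = k C(2k,k), because the summand
--     C(2k,q)(k-q) = k C(2k-1,q) - k C(2k-1,q-1) telescopes;
--   * the recurrence S_{m+2}(k) + 2k(2k-1) S_m(k-1) = k² S_m(k), because
--     q(2k-q) C(2k,q) = 2k(2k-1) C(2k-2,q-1) and (k-q)² + q(2k-q) = k²;
-- together with k C(2k,k) = 2(2k-1) C(2k-2,k-1) this turns the induction
-- step into a ring identity.

module Pascal where

  open import Data.Nat using (ℕ; zero; suc; _+_; _*_; s≤s; z≤n)
  open import Data.Nat.Properties using (+-cancelˡ-≡; *-cancelˡ-≡; *-zeroʳ; *-comm; *-commutativeSemigroup)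
  open import Data.Nat.Combinatorics using (_C_; nCn≡1; nCk≡nC[n∸k]; nCk+nC[k+1]≡[n+1]C[k+1])
  open import Data.Nat.Combinatorics.Specification using (k>n⇒nCk≡0)
  open import Data.Nat.Tactic.RingSolver using (solve-∀)
  open import Algebra.Properties.CommutativeSemigroup *-commutativeSemigroup using (x∙yz≈y∙xz)
  open import Relation.Binary.PropositionalEquality using (_≡_; refl; sym; trans; cong; cong₂; module ≡-Reasoning)
  open ≡-Reasoning

  -- Binomial coefficients given by Pascal's rule; structural recursion
  -- makes the identities below provable by induction.
  binom : ℕ → ℕ → ℕ
  binom zero    zero    = 1
  binom zero    (suc k) = 0
  binom (suc n) zero    = 1
  binom (suc n) (suc k) = binom n k + binom n (suc k)

  binom≡C : ∀ n k → binom n k ≡ n C k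
  binom≡C zero    zero    = sym (nCn≡1 0)
  binom≡C zero    (suc k) = sym (k>n⇒nCk≡0 (s≤s (z≤n {k})))
  binom≡C (suc n) zero    = sym (trans (nCk≡nC[n∸k] (z≤n {suc n})) (nCn≡1 (suc n)))
  binom≡C (suc n) (suc k) =
    trans (cong₂ _+_ (binom≡C n k) (binom≡C n (suc k))) (nCk+nC[k+1]≡[n+1]C[k+1] n k)

  binom-n-1 : ∀ n → binom n 1 ≡ n
  binom-n-1 zero          = refl
  binom-n-1 (suc zero)    = refl
  binom-n-1 (suc (suc n)) = cong suc (binom-n-1 (suc n))

  absorption : ∀ n k → suc k * binom (suc n) (suc k) ≡ suc n * binom n k
  absorption zero    zero    = refl
  absorption zero    (suc k) = *-zeroʳ (suc (suc k))
  absorption (suc n) zero    = begin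
    1 * (1 + binom (suc n) 1) ≡⟨ cong (λ b → 1 * (1 + b)) (binom-n-1 (suc n)) ⟩
    1 * (2 + n)               ≡⟨ *-comm 1 (2 + n) ⟩
    (2 + n) * 1               ∎
  absorption (suc n) (suc k) = begin
    (2 + k) * ((a + b) + c)               ≡⟨ distribute k a b c ⟩
    (1 + k) * (a + b) + (a + b) + (2 + k) * c
      ≡⟨ cong₂ (λ u v → u + (a + b) + v) (absorption n k) (absorption n (suc k)) ⟩
    (1 + n) * a + (a + b) + (1 + n) * b   ≡⟨ collect n a b ⟩
    (2 + n) * (a + b)                     ∎
    where
      a = binom n k
      b = binom n (suc k)
      c = binom (suc n) (suc (suc k))
      distribute : ∀ k a b c → (2 + k) * ((a + b) + c) ≡ (1 + k) * (a + b) + (a + b) + (2 + k) * c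
      distribute = solve-∀
      collect : ∀ n a b → (1 + n) * a + (a + b) + (1 + n) * b ≡ (2 + n) * (a + b)
      collect = solve-∀

  ratio : ∀ {M} q e → q + e ≡ M → suc q * binom (suc M) (suc q) ≡ suc e * binom (suc M) q
  ratio q e refl = +-cancelˡ-≡ ((1 + q) * x) _ _ (begin
    (1 + q) * x + (1 + q) * y ≡⟨ split q x y ⟩
    (1 + q) * (x + y)         ≡⟨ absorption (suc (q + e)) q ⟩
    (2 + (q + e)) * x         ≡⟨ regroup q e x ⟩
    (1 + q) * x + (1 + e) * x ∎)
    where
      x = binom (suc (q + e)) q
      y = binom (suc (q + e)) (suc q)
      split : ∀ q x y → (1 + q) * x + (1 + q) * y ≡ (1 + q) * (x + y)
      split = solve-∀
      regroup : ∀ q e x → (2 + (q + e)) * x ≡ (1 + q) * x + (1 + e) * x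
      regroup = solve-∀

  complement : ∀ {M} q e → q + e ≡ M → suc e * binom (suc M) q ≡ suc M * binom M q
  complement {M} q e q+e≡M = trans (sym (ratio q e q+e≡M)) (absorption M q)

  doubleAbsorption : ∀ {M} q e → q + e ≡ M →
    suc q * (suc e * binom (2 + M) (suc q)) ≡ (2 + M) * (suc M * binom M q)
  doubleAbsorption {M} q e q+e≡M = begin
    suc q * (suc e * binom (2 + M) (suc q)) ≡⟨ x∙yz≈y∙xz (suc q) (suc e) _ ⟩
    suc e * (suc q * binom (2 + M) (suc q)) ≡⟨ cong (suc e *_) (absorption (suc M) q) ⟩
    suc e * ((2 + M) * binom (suc M) q)     ≡⟨ x∙yz≈y∙xz (suc e) (2 + M) (binom (suc M) q) ⟩
    (2 + M) * (suc e * binom (suc M) q)     ≡⟨ cong ((2 + M) *_) (complement q e q+e≡M) ⟩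
    (2 + M) * (suc M * binom M q)           ∎

  middle : ∀ {N} n → n + n ≡ N → binom (suc N) (suc n) ≡ binom (suc N) n
  middle n n+n≡N = *-cancelˡ-≡ _ _ (suc n) (ratio n n n+n≡N)

  central : ∀ {N} n → n + n ≡ N → suc n * binom (2 + N) (suc n) ≡ 2 * (suc N * binom N n)
  central n refl = begin
    suc n * binom (2 + (n + n)) (suc n)  ≡⟨ absorption (suc (n + n)) n ⟩
    (2 + (n + n)) * x                    ≡⟨ factorTwo n x ⟩
    2 * (suc n * x)                      ≡⟨ cong (2 *_) (complement n n refl) ⟩
    2 * (suc (n + n) * binom (n + n) n)  ∎
    where
      x = binom (suc (n + n)) n
      factorTwo : ∀ n x → (2 + (n + n)) * x ≡ 2 * ((1 + n) * x)
      factorTwo = solve-∀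

module Moments where

  open import Data.Nat using (ℕ; zero; suc; _+_; _*_; _∸_; _^_; _<_; s≤s; z≤n)
  open import Data.Nat.Properties using (+-assoc; +-identityʳ; *-suc; *-distribˡ-+; *-zeroʳ; <⇒≤; m+[n∸m]≡n)
  open import Data.Nat.Combinatorics using (_C_)
  open import Data.Nat.ListAction using (sum)
  open import Data.Nat.Tactic.RingSolver using (solve-∀)
  open import Data.List using (map; applyUpTo)
  open import Function using (_∘_)
  open import Relation.Binary.PropositionalEquality using (_≡_; refl; sym; trans; cong; cong₂; module ≡-Reasoning)
  open ≡-Reasoning
  open import Defs using (calS)
  open Pascal

  Σ< : ℕ → (ℕ → ℕ) → ℕ
  Σ< zero    f = 0
  Σ< (suc n) f = f 0 + Σ< n (f ∘ suc)

  sum-applyUpTo : ∀ {A : Set} (f : A → ℕ) (h : ℕ → A) n → sum (map f (applyUpTo h n)) ≡ Σ< n (f ∘ h)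
  sum-applyUpTo f h zero    = refl
  sum-applyUpTo f h (suc n) = cong (f (h 0) +_) (sum-applyUpTo f (h ∘ suc) n)

  Σ<-cong : ∀ n {f g : ℕ → ℕ} → (∀ q → q < n → f q ≡ g q) → Σ< n f ≡ Σ< n g
  Σ<-cong zero    f≡g = refl
  Σ<-cong (suc n) f≡g = cong₂ _+_ (f≡g 0 (s≤s z≤n)) (Σ<-cong n (λ q q<n → f≡g (suc q) (s≤s q<n)))

  Σ<-+ : ∀ n (f g : ℕ → ℕ) → Σ< n (λ q → f q + g q) ≡ Σ< n f + Σ< n g
  Σ<-+ zero    f g = refl
  Σ<-+ (suc n) f g = trans (cong (f 0 + g 0 +_) (Σ<-+ n (f ∘ suc) (g ∘ suc)))
                           (interchange (f 0) (g 0) (Σ< n (f ∘ suc)) (Σ< n (g ∘ suc)))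
    where
      interchange : ∀ a b c d → (a + b) + (c + d) ≡ (a + c) + (b + d)
      interchange = solve-∀

  Σ<-* : ∀ n c (f : ℕ → ℕ) → Σ< n (λ q → c * f q) ≡ c * Σ< n f
  Σ<-* zero    c f = sym (*-zeroʳ c)
  Σ<-* (suc n) c f = trans (cong (c * f 0 +_) (Σ<-* n c (f ∘ suc))) (sym (*-distribˡ-+ c (f 0) _))

  telescope : ∀ n (a g : ℕ → ℕ) → (∀ q → q < n → g q + a q ≡ a (suc q)) → Σ< n g + a 0 ≡ a n
  telescope zero    a g step = refl
  telescope (suc n) a g step = begin
    (g 0 + Σ< n (g ∘ suc)) + a 0 ≡⟨ swap (g 0) (Σ< n (g ∘ suc)) (a 0) ⟩
    Σ< n (g ∘ suc) + (g 0 + a 0) ≡⟨ cong (Σ< n (g ∘ suc) +_) (step 0 (s≤s z≤n)) ⟩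
    Σ< n (g ∘ suc) + a 1         ≡⟨ telescope n (a ∘ suc) (g ∘ suc) (λ q q<n → step (suc q) (s≤s q<n)) ⟩
    a (suc n)                    ∎
    where
      swap : ∀ x y z → (x + y) + z ≡ y + (x + z)
      swap = solve-∀

  T : ℕ → ℕ → ℕ → ℕ
  T N m k = Σ< k (λ q → binom N q * (k ∸ q) ^ m)

  S : ℕ → ℕ → ℕ
  S m k = T (2 * k) m k

  calS≡S : ∀ m k → calS m k ≡ S m k
  calS≡S m k = trans (sum-applyUpTo term (λ q → q) k)
                     (Σ<-cong k (λ q _ → cong (_* (k ∸ q) ^ m) (sym (binom≡C (2 * k) q))))
    where
      term : ℕ → ℕ
      term q = ((2 * k) C q) * (k ∸ q) ^ m

  -- For k = n+1 the row index 2k is 2 + 2n, on which Pascal's rule computes.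
  S-suc : ∀ m n → S m (suc n) ≡ T (2 + 2 * n) m (suc n)
  S-suc m n = cong (λ N → T N m (suc n)) (*-suc 2 n)

  double : ∀ n → n + n ≡ 2 * n
  double n = cong (n +_) (sym (+-identityʳ n))

  centralBinomial : ∀ n → suc n * binom (2 * suc n) (suc n) ≡ 2 * ((1 + 2 * n) * binom (2 * n) n)
  centralBinomial n = trans (cong (λ M → suc n * binom M (suc n)) (*-suc 2 n)) (central n (double n))

  firstMomentStep : ∀ {n N} t d → t + d ≡ n → n + n ≡ N →
    binom (2 + N) (suc t) * (d * 1) + suc n * binom (suc N) t ≡ suc n * binom (suc N) (suc t)
  firstMomentStep t d refl refl = begin
    (A + B) * (d * 1) + suc (t + d) * A ≡⟨ expand t d A B ⟩
    d * B + suc e * A                   ≡⟨ cong (d * B +_) (sym (ratio t e (rowIndex t d))) ⟩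
    d * B + suc t * B                   ≡⟨ collect t d B ⟩
    suc (t + d) * B                     ∎
    where
      e = t + (d + d)
      A = binom (suc ((t + d) + (t + d))) t
      B = binom (suc ((t + d) + (t + d))) (suc t)
      rowIndex : ∀ t d → t + (t + (d + d)) ≡ (t + d) + (t + d)
      rowIndex = solve-∀
      expand : ∀ t d A B → (A + B) * (d * 1) + (1 + (t + d)) * A ≡ d * B + (1 + (t + (d + d))) * A
      expand = solve-∀
      collect : ∀ t d B → d * B + (1 + t) * B ≡ (1 + (t + d)) * B
      collect = solve-∀

  -- The summand is
  -- k C(2k-1,q) - k C(2k-1,q-1), so the sum telescopes to k C(2k-1,k-1),
  -- which is half of k C(2k,k) by the symmetry of the middle of row 2k-1.
  firstMoment : ∀ k → 2 * S 1 k ≡ k * binom (2 * k) k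
  firstMoment zero    = refl
  firstMoment (suc n) = begin
    2 * S 1 k                                  ≡⟨ cong (2 *_) (trans (S-suc 1 n) (sym (+-identityʳ _))) ⟩
    2 * (T (2 + N) 1 k + 0)                    ≡⟨ cong (2 *_) (telescope k partial term step) ⟩
    2 * (k * binom (suc N) n)                  ≡⟨ twice k (binom (suc N) n) ⟩
    k * (binom (suc N) n + binom (suc N) n)    ≡⟨ cong (λ b → k * (binom (suc N) n + b)) (sym (middle n (double n))) ⟩
    k * binom (2 + N) k                        ≡⟨ cong (λ M → k * binom M k) (sym (*-suc 2 n)) ⟩
    k * binom (2 * k) k                        ∎
    where
      k = suc n
      N = 2 * n
      term : ℕ → ℕ
      term q = binom (2 + N) q * (k ∸ q) ^ 1
      partial : ℕ → ℕ
      partial zero    = 0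
      partial (suc q) = k * binom (suc N) q
      twice : ∀ k x → 2 * (k * x) ≡ k * (x + x)
      twice = solve-∀
      firstStep : ∀ k → 1 * (k * 1) + 0 ≡ k * 1
      firstStep = solve-∀
      step : ∀ q → q < k → term q + partial q ≡ partial (suc q)
      step zero    _         = firstStep k
      step (suc t) (s≤s t<n) = firstMomentStep t (n ∸ t) (m+[n∸m]≡n (<⇒≤ t<n)) (double n)

  recurrenceStep : ∀ {n N} q d x → q + d ≡ n → n + n ≡ N →
    binom (2 + N) (suc q) * (d * (d * x)) + (2 + N) * (1 + N) * (binom N q * x)
      ≡ (suc n * suc n) * (binom (2 + N) (suc q) * x)
  recurrenceStep q d x refl refl = begin
    W * (d * (d * x)) + (2 + N) * (1 + N) * (binom N q * x)
      ≡⟨ regroup W (d * (d * x)) (2 + N) (1 + N) (binom N q) x ⟩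
    W * (d * (d * x)) + (2 + N) * ((1 + N) * binom N q) * x
      ≡⟨ cong (λ c → W * (d * (d * x)) + c * x) (sym (doubleAbsorption q e (rowIndex q d))) ⟩
    W * (d * (d * x)) + suc q * (suc e * W) * x
      ≡⟨ square W d x q ⟩
    (suc (q + d) * suc (q + d)) * (W * x) ∎
    where
      N = (q + d) + (q + d)
      e = q + (d + d)
      W = binom (2 + N) (suc q)
      rowIndex : ∀ q d → q + (q + (d + d)) ≡ (q + d) + (q + d)
      rowIndex = solve-∀
      regroup : ∀ w y a b c x → w * y + a * b * (c * x) ≡ w * y + a * (b * c) * x
      regroup = solve-∀
      square : ∀ W d x q → W * (d * (d * x)) + (1 + q) * ((1 + (q + (d + d))) * W) * x
                             ≡ ((1 + (q + d)) * (1 + (q + d))) * (W * x)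
      square = solve-∀

  recurrence : ∀ m n → S (2 + m) (suc n) + (2 + 2 * n) * (1 + 2 * n) * S m n ≡ (suc n * suc n) * S m (suc n)
  recurrence m n = begin
    S (2 + m) k + c * S m n                 ≡⟨ cong (_+ c * S m n) (S-suc (2 + m) n) ⟩
    (high 0 + Σ< n (high ∘ suc)) + c * Σ< n low
      ≡⟨ +-assoc (high 0) _ _ ⟩
    high 0 + (Σ< n (high ∘ suc) + c * Σ< n low)
      ≡⟨ cong (high 0 +_) (sym (trans (Σ<-+ n (high ∘ suc) (λ q → c * low q)) (cong (Σ< n (high ∘ suc) +_) (Σ<-* n c low)))) ⟩
    high 0 + Σ< n (λ q → high (suc q) + c * low q)
      ≡⟨ cong₂ _+_ (leading k (k ^ m)) (Σ<-cong n summand) ⟩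
    kk * mid 0 + Σ< n (λ q → kk * mid (suc q))
      ≡⟨ trans (cong (kk * mid 0 +_) (Σ<-* n kk (mid ∘ suc))) (sym (*-distribˡ-+ kk (mid 0) _)) ⟩
    kk * (mid 0 + Σ< n (mid ∘ suc))         ≡⟨ cong (kk *_) (sym (S-suc m n)) ⟩
    kk * S m k                              ∎
    where
      k = suc n
      kk = k * k
      N = 2 * n
      c = (2 + N) * (1 + N)
      high mid low : ℕ → ℕ
      high q = binom (2 + N) q * (k ∸ q) ^ (2 + m)
      mid q  = binom (2 + N) q * (k ∸ q) ^ m
      low q  = binom N q * (n ∸ q) ^ m
      leading : ∀ k y → 1 * (k * (k * y)) ≡ (k * k) * (1 * y)
      leading = solve-∀
      summand : ∀ q → q < n → high (suc q) + c * low q ≡ kk * mid (suc q)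
      summand q q<n = recurrenceStep q (n ∸ q) ((n ∸ q) ^ m) (m+[n∸m]≡n (<⇒≤ q<n)) (double n)

module Polynomials where

  open import Relation.Nullary.Decidable.Core using (dec⇒maybe)
  open import Data.Nat using (ℕ; zero; suc)
  open import Data.List using ([]; _∷_)
  open import Data.Rational using (ℚ; 0ℚ; 1ℚ; _+_; _*_; _-_; -_)
  open import Data.Rational.Properties using (+-*-commutativeRing; _≟_; +-identityˡ; +-identityʳ; *-zeroʳ)
  import Tactic.RingSolver.Core.AlmostCommutativeRing as ACR
  open import Tactic.RingSolver using (solve-∀)
  open import Level using (0ℓ)
  open import Relation.Binary.PropositionalEquality using (_≡_; refl; sym; trans; cong; cong₂; module ≡-Reasoning)
  open ≡-Reasoning
  open import Defs using (Poly; eval)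

  ℚ-ring : ACR.AlmostCommutativeRing 0ℓ 0ℓ
  ℚ-ring = ACR.fromCommutativeRing +-*-commutativeRing (λ x → dec⇒maybe (0ℚ ≟ x))

  infixl 6 _⊕_

  _⊕_ : Poly → Poly → Poly
  []      ⊕ q       = q
  (a ∷ p) ⊕ []      = a ∷ p
  (a ∷ p) ⊕ (b ∷ q) = (a + b) ∷ (p ⊕ q)

  scale : ℚ → Poly → Poly
  scale c []      = []
  scale c (a ∷ p) = c * a ∷ scale c p

  infixl 6 _⊖_

  _⊖_ : Poly → Poly → Poly
  p ⊖ q = p ⊕ scale (- 1ℚ) q

  X* : Poly → Poly
  X* p = 0ℚ ∷ p

  -- Translation p(x) ↦ p(x - 1), by Horner's scheme: (a + x p)(x-1) = a + (x-1) p(x-1).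
  shift : Poly → Poly
  shift []      = []
  shift (a ∷ p) = (a ∷ []) ⊕ (X* (shift p) ⊖ shift p)

  eval-⊕ : ∀ p q x → eval (p ⊕ q) x ≡ eval p x + eval q x
  eval-⊕ []      q       x = sym (+-identityˡ (eval q x))
  eval-⊕ (a ∷ p) []      x = sym (+-identityʳ (a + x * eval p x))
  eval-⊕ (a ∷ p) (b ∷ q) x = trans (cong (λ v → (a + b) + x * v) (eval-⊕ p q x))
                                   (interchange a b x (eval p x) (eval q x))
    where
      interchange : ∀ a b x u v → (a + b) + x * (u + v) ≡ (a + x * u) + (b + x * v)
      interchange = solve-∀ ℚ-ring

  eval-scale : ∀ c p x → eval (scale c p) x ≡ c * eval p x
  eval-scale c []      x = sym (*-zeroʳ c)
  eval-scale c (a ∷ p) x = trans (cong (λ v → c * a + x * v) (eval-scale c p x))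
                                 (factor c a x (eval p x))
    where
      factor : ∀ c a x u → c * a + x * (c * u) ≡ c * (a + x * u)
      factor = solve-∀ ℚ-ring

  eval-⊖ : ∀ p q x → eval (p ⊖ q) x ≡ eval p x - eval q x
  eval-⊖ p q x = trans (eval-⊕ p (scale (- 1ℚ) q) x)
                       (trans (cong (eval p x +_) (eval-scale (- 1ℚ) q x)) (minus (eval p x) (eval q x)))
    where
      minus : ∀ u v → u + - 1ℚ * v ≡ u - v
      minus = solve-∀ ℚ-ring

  eval-X* : ∀ p x → eval (X* p) x ≡ x * eval p x
  eval-X* p x = +-identityˡ (x * eval p x)

  eval-shift : ∀ p x → eval (shift p) x ≡ eval p (x - 1ℚ)
  eval-shift []      x = refl
  eval-shift (a ∷ p) x = begin
    eval ((a ∷ []) ⊕ (X* s ⊖ s)) x              ≡⟨ eval-⊕ (a ∷ []) (X* s ⊖ s) x ⟩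
    eval (a ∷ []) x + eval (X* s ⊖ s) x         ≡⟨ cong (eval (a ∷ []) x +_) (eval-⊖ (X* s) s x) ⟩
    eval (a ∷ []) x + (eval (X* s) x - eval s x) ≡⟨ cong (λ u → eval (a ∷ []) x + (u - eval s x)) (eval-X* s x) ⟩
    (a + x * 0ℚ) + (x * eval s x - eval s x)    ≡⟨ horner a x (eval s x) ⟩
    a + (x - 1ℚ) * eval s x                     ≡⟨ cong (λ v → a + (x - 1ℚ) * v) (eval-shift p x) ⟩
    a + (x - 1ℚ) * eval p (x - 1ℚ)              ∎
    where
      s = shift p
      horner : ∀ a x u → (a + x * 0ℚ) + (x * u - u) ≡ a + (x - 1ℚ) * u
      horner = solve-∀ ℚ-ring

  P : ℕ → Poly
  P zero    = 1ℚ ∷ []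
  P (suc r) = X* (X* (P r)) ⊖ X* (X* s ⊖ s)
    where s = shift (P r)

  eval-P-suc : ∀ r x → eval (P (suc r)) x ≡ x * x * eval (P r) x - x * (x - 1ℚ) * eval (P r) (x - 1ℚ)
  eval-P-suc r x = begin
    eval (X* (X* p) ⊖ X* (X* s ⊖ s)) x               ≡⟨ eval-⊖ (X* (X* p)) (X* (X* s ⊖ s)) x ⟩
    eval (X* (X* p)) x - eval (X* (X* s ⊖ s)) x      ≡⟨ cong₂ _-_ (trans (eval-X* (X* p) x) (cong (x *_) (eval-X* p x)))
                                                                  (eval-X* (X* s ⊖ s) x) ⟩
    x * (x * eval p x) - x * eval (X* s ⊖ s) x       ≡⟨ cong (λ v → x * (x * eval p x) - x * v)
                                                              (trans (eval-⊖ (X* s) s x) (cong (_- eval s x) (eval-X* s x))) ⟩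
    x * (x * eval p x) - x * (x * eval s x - eval s x) ≡⟨ collect x (eval p x) (eval s x) ⟩
    x * x * eval p x - x * (x - 1ℚ) * eval s x       ≡⟨ cong (λ v → x * x * eval p x - x * (x - 1ℚ) * v) (eval-shift p x) ⟩
    x * x * eval p x - x * (x - 1ℚ) * eval p (x - 1ℚ) ∎
    where
      p = P r
      s = shift p
      collect : ∀ x u v → x * (x * u) - x * (x * v - v) ≡ x * x * u - x * (x - 1ℚ) * v
      collect = solve-∀ ℚ-ring

module Embedding where

  import Data.Nat as ℕ
  open import Data.Integer as ℤ using (+_)
  import Data.Integer.Properties as ℤ
  open import Data.Integer.Tactic.RingSolver using (solve-∀)
  open import Data.Rational using (ℚ; _+_; _*_; _/_; toℚᵘ)
  open import Data.Rational.Properties using (toℚᵘ-injective; toℚᵘ-fromℚᵘ; toℚᵘ-homo-+; toℚᵘ-homo-*)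
  open import Data.Rational.Unnormalised using (mkℚᵘ; *≡*)
  open import Data.Rational.Unnormalised.Properties using (≃-trans; ≃-sym; +-cong; *-cong; *-congˡ)
  open import Relation.Binary.PropositionalEquality using (_≡_; sym; trans; cong)
  open import Defs using (toℚ)

  toℚ-+ : ∀ m n → toℚ (m ℕ.+ n) ≡ toℚ m + toℚ n
  toℚ-+ m n = toℚᵘ-injective
    (≃-trans (toℚᵘ-fromℚᵘ (mkℚᵘ (+ (m ℕ.+ n)) 0))
    (≃-trans (*≡* cross)
    (≃-sym (≃-trans (toℚᵘ-homo-+ (toℚ m) (toℚ n))
                    (+-cong (toℚᵘ-fromℚᵘ (mkℚᵘ (+ m) 0)) (toℚᵘ-fromℚᵘ (mkℚᵘ (+ n) 0)))))))
    where
      units : ∀ a b → (a ℤ.+ b) ℤ.* (ℤ.1ℤ ℤ.* ℤ.1ℤ) ≡ (a ℤ.* ℤ.1ℤ ℤ.+ b ℤ.* ℤ.1ℤ) ℤ.* ℤ.1ℤ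
      units = solve-∀
      cross : + (m ℕ.+ n) ℤ.* (+ 1 ℤ.* + 1) ≡ (+ m ℤ.* + 1 ℤ.+ + n ℤ.* + 1) ℤ.* + 1
      cross = trans (cong (ℤ._* ℤ.1ℤ) (ℤ.pos-+ m n)) (units (+ m) (+ n))

  toℚ-* : ∀ m n → toℚ (m ℕ.* n) ≡ toℚ m * toℚ n
  toℚ-* m n = toℚᵘ-injective
    (≃-trans (toℚᵘ-fromℚᵘ (mkℚᵘ (+ (m ℕ.* n)) 0))
    (≃-trans (*≡* cross)
    (≃-sym (≃-trans (toℚᵘ-homo-* (toℚ m) (toℚ n))
                    (*-cong (toℚᵘ-fromℚᵘ (mkℚᵘ (+ m) 0)) (toℚᵘ-fromℚᵘ (mkℚᵘ (+ n) 0)))))))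
    where
      cross : + (m ℕ.* n) ℤ.* (+ 1 ℤ.* + 1) ≡ (+ m ℤ.* + n) ℤ.* + 1
      cross = trans (ℤ.*-identityʳ (+ (m ℕ.* n))) (trans (ℤ.pos-* m n) (sym (ℤ.*-identityʳ (+ m ℤ.* + n))))

  ½ : ℚ
  ½ = + 1 / 2

  k/2≡½*k : ∀ k → (+ k) / 2 ≡ ½ * toℚ k
  k/2≡½*k k = toℚᵘ-injective
    (≃-trans (toℚᵘ-fromℚᵘ (mkℚᵘ (+ k) 1))
    (≃-trans (*≡* (cong (ℤ._* + 2) (sym (ℤ.*-identityˡ (+ k)))))
    (≃-sym (≃-trans (toℚᵘ-homo-* ½ (toℚ k)) (*-congˡ (toℚᵘ-fromℚᵘ (mkℚᵘ (+ k) 0)))))))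

module MomentPolynomials where

  open import Data.Nat as ℕ using (zero; suc)
  open import Data.Nat.Properties using (*-suc)
  import Data.Nat.Tactic.RingSolver as ℕ-Solver
  import Data.Integer as ℤ
  open import Data.Rational using (ℚ; 0ℚ; 1ℚ; _+_; _*_; _-_; _/_)
  open import Data.Rational.Properties using (*-zeroʳ; *-assoc; *-identityˡ)
  open import Tactic.RingSolver using (solve-∀)
  open import Relation.Binary.PropositionalEquality using (_≡_; sym; trans; cong; cong₂; module ≡-Reasoning)
  open ≡-Reasoning
  open import Defs using (eval; toℚ)
  open Pascal using (binom)
  open Moments using (S; firstMoment; recurrence; centralBinomial)
  open Polynomials using (ℚ-ring; P; eval-P-suc)
  open Embedding using (toℚ-+; toℚ-*; ½; k/2≡½*k)

  -- The rational number 2, written so that the ring solver sees 1 + 1.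
  two : ℚ
  two = 1ℚ + 1ℚ

  stepAlgebra : ∀ k n a b s cₖ cₙ eₖ eₙ →
    a + (two * k) * (1ℚ + two * n) * b ≡ (k * k) * s →
    k * cₖ ≡ two * ((1ℚ + two * n) * cₙ) →
    two * s ≡ eₖ * (k * cₖ) →
    two * b ≡ eₙ * (n * cₙ) →
    two * a ≡ (k * k * eₖ - k * n * eₙ) * (k * cₖ)
  stepAlgebra k n a b s cₖ cₙ eₖ eₙ rec cen claimₖ claimₙ = begin
    two * a                                                  ≡⟨ isolate a b c ⟩
    two * (a + c * b) - c * (two * b)                        ≡⟨ cong₂ (λ u v → two * u - c * v) rec claimₙ ⟩
    two * ((k * k) * s) - c * (eₙ * (n * cₙ))                ≡⟨ regroup k n s cₙ eₙ ⟩
    k * k * (two * s) - k * n * eₙ * (two * ((1ℚ + two * n) * cₙ))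
      ≡⟨ cong₂ (λ u v → k * k * u - k * n * eₙ * v) claimₖ (sym cen) ⟩
    k * k * (eₖ * (k * cₖ)) - k * n * eₙ * (k * cₖ)         ≡⟨ factor k n eₖ eₙ (k * cₖ) ⟩
    (k * k * eₖ - k * n * eₙ) * (k * cₖ)                     ∎
    where
      c = (two * k) * (1ℚ + two * n)
      isolate : ∀ a b c → (1ℚ + 1ℚ) * a ≡ (1ℚ + 1ℚ) * (a + c * b) - c * ((1ℚ + 1ℚ) * b)
      isolate = solve-∀ ℚ-ring
      regroup : ∀ k n s cₙ eₙ →
        (1ℚ + 1ℚ) * ((k * k) * s) - ((1ℚ + 1ℚ) * k) * (1ℚ + (1ℚ + 1ℚ) * n) * (eₙ * (n * cₙ))
          ≡ k * k * ((1ℚ + 1ℚ) * s) - k * n * eₙ * ((1ℚ + 1ℚ) * ((1ℚ + (1ℚ + 1ℚ) * n) * cₙ))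
      regroup = solve-∀ ℚ-ring
      factor : ∀ k n eₖ eₙ w → k * k * (eₖ * w) - k * n * eₙ * w ≡ (k * k * eₖ - k * n * eₙ) * w
      factor = solve-∀ ℚ-ring

  toℚ-suc : ∀ n → toℚ (suc n) ≡ 1ℚ + toℚ n
  toℚ-suc n = toℚ-+ 1 n

  toℚ-pred : ∀ n → toℚ (suc n) - 1ℚ ≡ toℚ n
  toℚ-pred n = trans (cong (_- 1ℚ) (toℚ-suc n)) (cancel (toℚ n))
    where
      cancel : ∀ y → (1ℚ + y) - 1ℚ ≡ y
      cancel = solve-∀ ℚ-ring

  toℚ-odd : ∀ n → toℚ (1 ℕ.+ 2 ℕ.* n) ≡ 1ℚ + two * toℚ n
  toℚ-odd n = trans (toℚ-+ 1 (2 ℕ.* n)) (cong (λ v → 1ℚ + v) (toℚ-* 2 n))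

  doubledMoment : ∀ r k → toℚ (2 ℕ.* S (2 ℕ.* r ℕ.+ 1) k) ≡ eval (P r) (toℚ k) * toℚ (k ℕ.* binom (2 ℕ.* k) k)
  doubledMoment zero    k       = trans (cong toℚ (firstMoment k)) (sym (constant (toℚ k) _))
    where
      constant : ∀ x y → (1ℚ + x * 0ℚ) * y ≡ y
      constant = solve-∀ ℚ-ring
  doubledMoment (suc r) zero    = sym (*-zeroʳ (eval (P (suc r)) (toℚ 0)))
  doubledMoment (suc r) (suc n) = begin
    toℚ (2 ℕ.* S (2 ℕ.* suc r ℕ.+ 1) k) ≡⟨ cong (λ j → toℚ (2 ℕ.* S j k)) (oddIndex r) ⟩
    toℚ (2 ℕ.* S (2 ℕ.+ m) k)          ≡⟨ toℚ-* 2 (S (2 ℕ.+ m) k) ⟩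
    two * a                              ≡⟨ stepAlgebra K y a b s cₖ cₙ eₖ eₙ recurrenceℚ centralℚ (claim k) (claim n) ⟩
    (K * K * eₖ - K * y * eₙ) * (K * cₖ) ≡⟨ cong₂ _*_ (sym evalₖ) (sym (toℚ-* k (binom (2 ℕ.* k) k))) ⟩
    eval (P (suc r)) K * toℚ (k ℕ.* binom (2 ℕ.* k) k) ∎
    where
      k = suc n
      m = 2 ℕ.* r ℕ.+ 1
      K = toℚ k
      y = toℚ n
      a = toℚ (S (2 ℕ.+ m) k)
      b = toℚ (S m n)
      s = toℚ (S m k)
      cₖ = toℚ (binom (2 ℕ.* k) k)
      cₙ = toℚ (binom (2 ℕ.* n) n)
      eₖ = eval (P r) K
      eₙ = eval (P r) y
      oddIndex : ∀ r → 2 ℕ.* suc r ℕ.+ 1 ≡ 2 ℕ.+ (2 ℕ.* r ℕ.+ 1)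
      oddIndex = ℕ-Solver.solve-∀
      claim : ∀ j → two * toℚ (S m j) ≡ eval (P r) (toℚ j) * (toℚ j * toℚ (binom (2 ℕ.* j) j))
      claim j = trans (sym (toℚ-* 2 (S m j)))
                      (trans (doubledMoment r j) (cong (eval (P r) (toℚ j) *_) (toℚ-* j (binom (2 ℕ.* j) j))))
      recurrenceℚ : a + (two * K) * (1ℚ + two * y) * b ≡ (K * K) * s
      recurrenceℚ = begin
        a + (two * K) * (1ℚ + two * y) * b
          ≡⟨ cong (λ c → a + c * b) (sym (cong₂ _*_ (trans (cong toℚ (sym (*-suc 2 n))) (toℚ-* 2 k)) (toℚ-odd n))) ⟩
        a + toℚ (2 ℕ.+ 2 ℕ.* n) * toℚ (1 ℕ.+ 2 ℕ.* n) * b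
          ≡⟨ sym (trans (toℚ-+ (S (2 ℕ.+ m) k) (c ℕ.* S m n))
                        (cong (a +_) (trans (toℚ-* c (S m n)) (cong (_* b) (toℚ-* (2 ℕ.+ 2 ℕ.* n) (1 ℕ.+ 2 ℕ.* n)))))) ⟩
        toℚ (S (2 ℕ.+ m) k ℕ.+ c ℕ.* S m n)
          ≡⟨ cong toℚ (recurrence m n) ⟩
        toℚ ((k ℕ.* k) ℕ.* S m k)
          ≡⟨ trans (toℚ-* (k ℕ.* k) (S m k)) (cong (_* s) (toℚ-* k k)) ⟩
        (K * K) * s ∎
        where
          c = (2 ℕ.+ 2 ℕ.* n) ℕ.* (1 ℕ.+ 2 ℕ.* n)
      centralℚ : K * cₖ ≡ two * ((1ℚ + two * y) * cₙ)
      centralℚ = begin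
        K * cₖ                                           ≡⟨ sym (toℚ-* k (binom (2 ℕ.* k) k)) ⟩
        toℚ (k ℕ.* binom (2 ℕ.* k) k)                   ≡⟨ cong toℚ (centralBinomial n) ⟩
        toℚ (2 ℕ.* ((1 ℕ.+ 2 ℕ.* n) ℕ.* binom (2 ℕ.* n) n))
          ≡⟨ trans (toℚ-* 2 (odd ℕ.* binom (2 ℕ.* n) n))
                   (cong (two *_) (trans (toℚ-* odd (binom (2 ℕ.* n) n)) (cong (_* cₙ) (toℚ-odd n)))) ⟩
        two * ((1ℚ + two * y) * cₙ)                      ∎
        where
          odd = 1 ℕ.+ 2 ℕ.* n
      evalₖ : eval (P (suc r)) K ≡ K * K * eₖ - K * y * eₙ
      evalₖ = trans (eval-P-suc r K)
                    (cong (λ z → K * K * eₖ - K * z * eval (P r) z) (toℚ-pred n))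

  oddMoment : ∀ r k → toℚ (S (2 ℕ.* r ℕ.+ 1) k) ≡ eval (P r) (toℚ k) * (((ℤ.+ k) / 2) * toℚ (binom (2 ℕ.* k) k))
  oddMoment r k = begin
    s                                 ≡⟨ halve s ⟩
    ½ * (two * s)                     ≡⟨ cong (½ *_) (sym (toℚ-* 2 (S m k))) ⟩
    ½ * toℚ (2 ℕ.* S m k)             ≡⟨ cong (½ *_) (doubledMoment r k) ⟩
    ½ * (e * toℚ (k ℕ.* binom (2 ℕ.* k) k)) ≡⟨ cong (λ v → ½ * (e * v)) (toℚ-* k (binom (2 ℕ.* k) k)) ⟩
    ½ * (e * (toℚ k * c))             ≡⟨ reorder ½ e (toℚ k) c ⟩
    e * ((½ * toℚ k) * c)             ≡⟨ cong (λ h → e * (h * c)) (sym (k/2≡½*k k)) ⟩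
    e * (((ℤ.+ k) / 2) * c)             ∎
    where
      m = 2 ℕ.* r ℕ.+ 1
      s = toℚ (S m k)
      e = eval (P r) (toℚ k)
      c = toℚ (binom (2 ℕ.* k) k)
      halve : ∀ x → x ≡ ½ * (two * x)
      halve x = sym (trans (sym (*-assoc ½ two x)) (*-identityˡ x))
      reorder : ∀ h e x c → h * (e * (x * c)) ≡ e * ((h * x) * c)
      reorder = solve-∀ ℚ-ring

open import Defs
open import Data.Nat using (ℕ; _+_; _*_; _≤_)
open import Data.Nat.Combinatorics using (_C_)
open import Data.Product using (∃)
open import Data.Integer using (+_)
open import Data.Rational using (ℚ; _/_) renaming (_*_ to _*ℚ_)
open import Relation.Binary.PropositionalEquality using (_≡_)

open import Data.Product using (_,_)
open import Relation.Binary.PropositionalEquality using (trans; cong)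
open Pascal using (binom≡C)
open Moments using (calS≡S)
open Polynomials using (P)
open MomentPolynomials using (oddMoment)

mainTheorem6 : ∃ λ (P : ℕ → Poly) → ∀ (r k : ℕ) → 1 ≤ k →
    toℚ (calS (2 * r + 1) k) ≡ eval (P r) (toℚ k) *ℚ (((+ k) / 2) *ℚ toℚ ((2 * k) C k))
mainTheorem6 = P , λ r k _ →
  trans (cong toℚ (calS≡S (2 * r + 1) k))
  (trans (oddMoment r k)
         (cong (λ c → eval (P r) (toℚ k) *ℚ (((+ k) / 2) *ℚ toℚ c)) (binom≡C (2 * k) k)))
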